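{- Let $\mathcal{M}$ be a regular matroid and let $\sigma$, $\sigma^*$ be a triangulating circuit signature and a triangulating cocircuit signature. Then for every basis $B$ of $\mathcal{M}$, the orientation $\mathrm{BBY}_{\sigma,\sigma^*}(B)=\overrightarrow{B}\cap\overrightarrow{B^*}$ (with $\overrightarrow{B}\in\mathcal{A}_\sigma$, $\overrightarrow{B^*}\in\mathcal{A}^*_{\sigma^*}$) is $(\sigma,\sigma^*)$-compatible.
   Context: $\mathcal{M}$ on ground set $E$ is represented by a totally unimodular real $r\times n$ matrix $M$ of rank $r>0$. Signed circuits (cocircuits) are $\{0,\pm1\}$-vectors in $\ker_{\mathbb R}M$ ($\operatorname{im}_{\mathbb R}M^T$) whose support is a circuit (cocircuit), identified with sets of arcs $\pm\mathbf{u}_e$. An orientation contains exactly one arc of each edge. For a basis $B$: $C(B,e)$ ($e\notin B$) is the unique circuit in $B\cup\{e\}$, $C^*(B,e)$ ($e\in B$) the unique cocircuit in $(E\setminus B)\cup\{e\}$. A circuit (cocircuit) signature chooses one signed version $\sigma(C)$ ($\sigma^*(C^*)$) of each circuit (cocircuit). $\mathcal{A}_\sigma$ assigns to $B$ the arc set $\overrightarrow{B}$ containing both arcs of each edge of $B$ and, for $e\notin B$, the arc of $e$ in $\sigma(C(B,e))$; $\mathcal{A}^*_{\sigma^*}$ assigns to $B$ the arc set $\overrightarrow{B^*}$ containing both arcs of each edge outside $B$ and, for $e\in B$, the arc of $e$ in $\sigma^*(C^*(B,e))$. $\sigma$ is triangulating if every signed circuit contained in some $\overrightarrow{B}\in\mathcal{A}_\sigma$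 belongs to $\sigma$; $\sigma^*$ is triangulating if every signed cocircuit contained in some $\overrightarrow{B^*}\in\mathcal{A}^*_{\sigma^*}$ belongs to $\sigma^*$. An orientation is $(\sigma,\sigma^*)$-compatible if every signed circuit contained in it is in $\sigma$ and every signed cocircuit contained in it is in $\sigma^*$. -}

module Defs where

open import Data.Nat using (ℕ; zero; suc)
open import Data.Fin using (Fin; zero; suc; punchIn; toℕ)
open import Data.Fin.Subset using (Subset; _∈_; _∉_; _⊂_; inside; outside)
open import Data.Integer using (ℤ; +_; -_) renaming (_+_ to _+ℤ_; _*_ to _*ℤ_)
open import Data.Rational using (ℚ; 0ℚ; _/_) renaming (_+_ to _+ℚ_; _*_ to _*ℚ_)
open import Data.Vec using (tabulate)
open import Data.Product using (Σ; ∃; _×_)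
open import Data.Sum using (_⊎_)
open import Relation.Nullary using (¬_)
open import Relation.Binary.PropositionalEquality using (_≡_; _≢_)
open import Function.Definitions using (Injective)

Matrix : ℕ → ℕ → Set
Matrix r n = Fin r → Fin n → ℤ

sumℤ : ∀ {m} → (Fin m → ℤ) → ℤ
sumℤ {zero}  f = + 0
sumℤ {suc m} f = f zero +ℤ sumℤ (λ i → f (suc i))

sumℚ : ∀ {m} → (Fin m → ℚ) → ℚ
sumℚ {zero}  f = 0ℚ
sumℚ {suc m} f = f zero +ℚ sumℚ (λ i → f (suc i))

altSign : ℕ → ℤ
altSign zero          = + 1
altSign (suc zero)    = - (+ 1)
altSign (suc (suc k)) = altSign k

det : ∀ {k} → (Fin k → Fin k → ℤ) → ℤ
det {zero}  A = + 1
det {suc k} A =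
  sumℤ (λ j → altSign (toℕ j) *ℤ (A zero j *ℤ det (λ a b → A (suc a) (punchIn j b))))

TotallyUnimodular : ∀ {r n} → Matrix r n → Set
TotallyUnimodular {r} {n} M =
  ∀ (k : ℕ) (rows : Fin k → Fin r) (cols : Fin k → Fin n) →
  Injective _≡_ _≡_ rows → Injective _≡_ _≡_ cols →
  let d = det (λ i j → M (rows i) (cols j)) in
  (d ≡ + 0) ⊎ (d ≡ + 1) ⊎ (d ≡ - (+ 1))

toℚ : ℤ → ℚ
toℚ z = z / 1

-- rows of M linearly independent (over ℚ, equivalently over ℝ): rank M = r
FullRowRank : ∀ {r n} → Matrix r n → Set
FullRowRank {r} {n} M =
  ∀ (y : Fin r → ℚ) → (∀ e → sumℚ (λ i → y i *ℚ toℚ (M i e)) ≡ 0ℚ) → ∀ i → y i ≡ 0ℚ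

Independent : ∀ {r n} → Matrix r n → Subset n → Set
Independent {r} {n} M S =
  ∀ (v : Fin n → ℚ) → (∀ e → e ∉ S → v e ≡ 0ℚ) →
  (∀ i → sumℚ (λ e → toℚ (M i e) *ℚ v e) ≡ 0ℚ) → ∀ e → v e ≡ 0ℚ

Basis : ∀ {r n} → Matrix r n → Subset n → Set
Basis {r} {n} M B =
  Independent M B × (∀ (S : Subset n) → B ⊂ S → ¬ Independent M S)

Circuit : ∀ {r n} → Matrix r n → Subset n → Set
Circuit {r} {n} M C =
  ¬ Independent M C × (∀ (D : Subset n) → D ⊂ C → Independent M D)

Cocircuit : ∀ {r n} → Matrix r n → Subset n → Set
Cocircuit {r} {n} M C =
  (∀ (B : Subset n) → Basis M B → ∃ λ e → e ∈ C × e ∈ B) ×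
  (∀ (D : Subset n) → D ⊂ C → Σ (Subset n) λ B → Basis M B × (∀ e → e ∈ D → e ∉ B))

data Sgn : Set where
  zer pos neg : Sgn

sgnℤ : Sgn → ℤ
sgnℤ zer = + 0
sgnℤ pos = + 1
sgnℤ neg = - (+ 1)

opp : Sgn → Sgn
opp zer = zer
opp pos = neg
opp neg = pos

SVec : ℕ → Set
SVec n = Fin n → Sgn

negV : ∀ {n} → SVec n → SVec n
negV X e = opp (X e)

isNZ : Sgn → Data.Fin.Subset.Side
isNZ zer = outside
isNZ pos = inside
isNZ neg = inside

supp : ∀ {n} → SVec n → Subset n
supp X = tabulate (λ e → isNZ (X e))

SignedCircuit : ∀ {r n} → Matrix r n → SVec n → Set
SignedCircuit {r} {n} M X =
  (∀ i → sumℤ (λ e → M i e *ℤ sgnℤ (X e)) ≡ + 0) × Circuit M (supp X)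

SignedCocircuit : ∀ {r n} → Matrix r n → SVec n → Set
SignedCocircuit {r} {n} M X =
  (Σ (Fin r → ℚ) λ y → ∀ e → sumℚ (λ i → y i *ℚ toℚ (M i e)) ≡ toℚ (sgnℤ (X e)))
  × Cocircuit M (supp X)

-- An arc set: (e , s) with s ∈ {pos, neg} is the arc s·u_e.
ArcSet : ℕ → Set₁
ArcSet n = Fin n → Sgn → Set

ContainedIn : ∀ {n} → SVec n → ArcSet n → Set
ContainedIn {n} X A = ∀ (e : Fin n) → X e ≢ zer → A e (X e)

IsCircuitSignature : ∀ {r n} → Matrix r n → (SVec n → Set) → Set
IsCircuitSignature {r} {n} M σ =
  (∀ X → σ X → SignedCircuit M X) ×
  (∀ X → SignedCircuit M X → σ X ⊎ σ (negV X)) ×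
  (∀ X → σ X → ¬ σ (negV X))

IsCocircuitSignature : ∀ {r n} → Matrix r n → (SVec n → Set) → Set
IsCocircuitSignature {r} {n} M σ* =
  (∀ X → σ* X → SignedCocircuit M X) ×
  (∀ X → SignedCocircuit M X → σ* X ⊎ σ* (negV X)) ×
  (∀ X → σ* X → ¬ σ* (negV X))

-- \vec{B} ∈ A_σ : both arcs of each e ∈ B; for e ∉ B the arc of e in
-- σ(C(B,e)), where C(B,e) is the (unique) circuit contained in B ∪ {e}.
ArrowB : ∀ {n} → (SVec n → Set) → Subset n → ArcSet n
ArrowB {n} σ B e s =
  s ≢ zer ×
  (e ∈ B ⊎
   (e ∉ B × Σ (SVec n) λ X → σ X × (∀ f → X f ≢ zer → f ∈ B ⊎ f ≡ e) × X e ≡ s))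

-- \vec{B*} ∈ A*_σ* : both arcs of each e ∉ B; for e ∈ B the arc of e in
-- σ*(C*(B,e)), where C*(B,e) is the (unique) cocircuit in (E∖B) ∪ {e}.
ArrowB* : ∀ {n} → (SVec n → Set) → Subset n → ArcSet n
ArrowB* {n} σ* B e s =
  s ≢ zer ×
  (e ∉ B ⊎
   (e ∈ B × Σ (SVec n) λ X → σ* X × (∀ f → X f ≢ zer → f ∉ B ⊎ f ≡ e) × X e ≡ s))

TriangulatingCircuitSig : ∀ {r n} → Matrix r n → (SVec n → Set) → Set
TriangulatingCircuitSig {r} {n} M σ =
  ∀ (B : Subset n) → Basis M B →
  ∀ X → SignedCircuit M X → ContainedIn X (ArrowB σ B) → σ X

TriangulatingCocircuitSig : ∀ {r n} → Matrix r n → (SVec n → Set) → Set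
TriangulatingCocircuitSig {r} {n} M σ* =
  ∀ (B : Subset n) → Basis M B →
  ∀ X → SignedCocircuit M X → ContainedIn X (ArrowB* σ* B) → σ* X

BBY : ∀ {n} → (SVec n → Set) → (SVec n → Set) → Subset n → ArcSet n
BBY σ σ* B e s = ArrowB σ B e s × ArrowB* σ* B e s

Compatible : ∀ {r n} → Matrix r n → (SVec n → Set) → (SVec n → Set) → ArcSet n → Set
Compatible {r} {n} M σ σ* O =
  (∀ X → SignedCircuit M X → ContainedIn X O → σ X) ×
  (∀ X → SignedCocircuit M X → ContainedIn X O → σ* X)

{-# OPTIONS --safe #-}
module Submission where

open import Defs
open import Data.Nat using (ℕ; _<_)
open import Data.Fin.Subset using (Subset)
open import Data.Product using (_,_; proj₁; proj₂)

-- BBY(B) lies inside both arrow sets of B, and a triangulating signature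
-- contains every signed (co)circuit lying inside an arrow set.

_⊆ᴬ_ : ∀ {n} → ArcSet n → ArcSet n → Set
A ⊆ᴬ A′ = ∀ e s → A e s → A′ e s

containedIn-mono : ∀ {n} {A A′ : ArcSet n} (X : SVec n) →
  A ⊆ᴬ A′ → ContainedIn X A → ContainedIn X A′
containedIn-mono X A⊆A′ X⊆A e Xe≢0 = A⊆A′ e (X e) (X⊆A e Xe≢0)

BBY⊆ArrowB : ∀ {n} (σ σ* : SVec n → Set) (B : Subset n) → BBY σ σ* B ⊆ᴬ ArrowB σ B
BBY⊆ArrowB σ σ* B e s = proj₁

BBY⊆ArrowB* : ∀ {n} (σ σ* : SVec n → Set) (B : Subset n) → BBY σ σ* B ⊆ᴬ ArrowB* σ* B
BBY⊆ArrowB* σ σ* B e s = proj₂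

lemma3p6 : (r n : ℕ) (M : Matrix r n) → 0 < r → FullRowRank M → TotallyUnimodular M →
    (σ σ* : SVec n → Set) → IsCircuitSignature M σ → IsCocircuitSignature M σ* →
    TriangulatingCircuitSig M σ → TriangulatingCocircuitSig M σ* →
    (B : Subset n) → Basis M B → Compatible M σ σ* (BBY σ σ* B)
lemma3p6 r n M _ _ _ σ σ* _ _ triangulating triangulating* B basis =
  (λ X circuit X⊆BBY →
     triangulating B basis X circuit (containedIn-mono X (BBY⊆ArrowB σ σ* B) X⊆BBY)) ,
  (λ X cocircuit X⊆BBY →
     triangulating* B basis X cocircuit (containedIn-mono X (BBY⊆ArrowB* σ σ* B) X⊆BBY))
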